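{- Let $\alpha\geq 2$ be an integer and $k$ a positive integer. Let $v_1,\ldots,v_k$ be vertices forming a complete graph whose edges are oriented arbitrarily; the orientation $v_i\to v_j$ means $v_i$ pays for the edge. In addition, each $v_i$ pays for edges to $\alpha-1$ separate leaves $l_{i:1},\ldots,l_{i:\alpha-1}$, which pay for no edges. Then in the network creation game with parameter $\alpha$ on these $k\alpha$ vertices, no single vertex can strictly decrease its cost by unilaterally changing its strategy. That is, this strategy tuple is a (weak) Nash equilibrium.
   Context: The network creation game. The agents are vertices, and there is a parameter $\alpha$. Each agent $v$ chooses a set $S_v$ of other vertices to which it buys (pays for) edges. The network is the undirected graph with edges $\{v,w\}$ for $w\in S_v$. Agent $v$'s cost is $\alpha|S_v|+\sum_u \mathrm{dist}(v,u)$, with distance $\infty$ between disconnected vertices. -}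

module Defs where

open import Data.Nat using (ℕ; zero; suc; _+_; _*_; _<_)
open import Data.Bool using (Bool; true; false; _∨_; _∧_; not; if_then_else_)
open import Data.Fin using (Fin; zero; suc; remQuot; _≟_)
open import Data.Fin.Subset using (Subset; ∣_∣; _∉_)
open import Data.Vec using (lookup; tabulate)
open import Data.List using (List; []; _∷_; allFin; sum; map)
open import Data.Bool.ListAction using (any)
open import Data.Unit using (⊤)
open import Relation.Nullary using (¬_)
open import Data.Vec using () renaming (toList to vtoList)
open import Data.Maybe using (Maybe; just; nothing)
open import Data.Product using (_×_; _,_)
open import Data.Empty using (⊥)
open import Relation.Nullary.Decidable using (⌊_⌋)
open import Relation.Binary.PropositionalEquality using (_≡_; _≢_)

-- Network creation game on vertex set Fin n.
-- A strategy of an agent is a subset of Fin n (the vertices it buys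
-- edges to); a strategy profile assigns one to every agent.

Profile : ℕ → Set
Profile n = Fin n → Subset n

ValidStrategy : ∀ {n} → Fin n → Subset n → Set
ValidStrategy v s = v ∉ s

adj : ∀ {n} → Profile n → Fin n → Fin n → Bool
adj S x y = lookup (S x) y ∨ lookup (S y) x

reach : ∀ {n} → Profile n → ℕ → Fin n → Fin n → Bool
reach S zero    x y = ⌊ x ≟ y ⌋
reach S (suc d) x y = reach S d x y ∨ any (λ z → adj S x z ∧ reach S d z y) (allFin _)

search : ∀ {n} → Profile n → ℕ → ℕ → Fin n → Fin n → Maybe ℕ
search S i zero       x y = nothing
search S i (suc fuel) x y =
  if reach S i x y then just i else search S (suc i) fuel x y

-- graph distance; nothing = ∞ (disconnected).  Any shortest path has
-- length < n, so searching d ∈ [0, n] is exhaustive.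
dist : ∀ {n} → Profile n → Fin n → Fin n → Maybe ℕ
dist {n} S x y = search S 0 (suc n) x y

_+∞_ : Maybe ℕ → Maybe ℕ → Maybe ℕ
just a  +∞ just b = just (a + b)
_       +∞ _      = nothing

sum∞ : List (Maybe ℕ) → Maybe ℕ
sum∞ []       = just 0
sum∞ (a ∷ as) = a +∞ sum∞ as

_<∞_ : Maybe ℕ → Maybe ℕ → Set
just a  <∞ just b  = a < b
just a  <∞ nothing = ⊤
nothing <∞ _       = ⊥

cost : ∀ {n} → ℕ → Profile n → Fin n → Maybe ℕ
cost α S v = just (α * ∣ S v ∣) +∞ sum∞ (map (dist S v) (allFin _))

deviate : ∀ {n} → Profile n → Fin n → Subset n → Profile n
deviate S v s w = if ⌊ w ≟ v ⌋ then s else S w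

NashEquilibrium : ∀ {n} → ℕ → Profile n → Set
NashEquilibrium α S =
  ∀ v (s : Subset _) → ValidStrategy v s → ¬ (cost α (deviate S v s) v <∞ cost α S v)

-- The construction.  Vertex set Fin (k * α); vertex p corresponds via
-- remQuot α p = (i , t) to v_i when t = 0, and to leaf l_{i:t} when
-- t ∈ {1,…,α-1}.

Tournament : ∀ {k} → (Fin k → Fin k → Bool) → Set
Tournament {k} o = ∀ (i j : Fin k) → i ≢ j → not (o i j) ≡ o j i

clique-profile : ∀ k α → (Fin k → Fin k → Bool) → Profile (k * α)
clique-profile k α o p = tabulate λ q → buys (remQuot α p) (remQuot α q)
  where
  buys : Fin k × Fin α → Fin k × Fin α → Bool
  buys (i , suc _) _            = false
  buys (i , zero)  (j , zero)   = not ⌊ i ≟ j ⌋ ∧ o i j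
  buys (i , zero)  (j , suc _)  = ⌊ i ≟ j ⌋

-- Write the cost of an agent v as a sum over targets y of α·[v buys y] + dist(v, y), and compare
-- the old and the new profile block by block, a block being a centre v_j with its α − 1 leaves.
-- Within a block each old term is at most the corresponding new one, with two exceptions that trade
-- α against distances: if a centre v_i ends up not adjacent to v_j, the block of v_j, which used to
-- cost at most (α + 1) + 2(α − 1), now costs at least 2 + 3(α − 1); if a leaf buys an edge to v_j,
-- that block, which used to cost 2 + 3(α − 1), now costs at least (α + 1) + 2(α − 1).  A centre
-- cannot drop an edge to one of its own leaves, since the leaf would become unreachable.

module Submission where

open import Defs
open import Data.Bool using (Bool; true; false; _∨_; _∧_; not)
open import Data.Bool.ListAction using (any)
open import Data.Bool.Properties
  using (T-≡; ∨-comm; ∨-zeroʳ; ∨-identityʳ; ∨-inverseʳ; ∧-conicalˡ; ∧-conicalʳ; not-¬)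
open import Data.Empty using (⊥-elim)
open import Data.Fin using (Fin; zero; suc; _≟_; _↑ˡ_; _↑ʳ_; combine)
open import Data.Fin.Properties as Fin
  using (toℕ<n; nonZeroIndex; remQuot-combine; combine-injective; combine-surjective)
open import Data.Fin.Subset using (Subset; ∣_∣)
open import Data.List using (tabulate; allFin; map)
open import Data.List.Membership.Propositional using (lose)
open import Data.List.Membership.Propositional.Properties using (∈-allFin)
open import Data.List.Properties using (map-tabulate)
open import Data.List.Relation.Unary.Any using (satisfied)
open import Data.List.Relation.Unary.Any.Properties using (any⁺; any⁻)
open import Data.Maybe using (Maybe; just; nothing)
open import Data.Maybe.Properties using (just-injective)
open import Data.Nat using (ℕ; zero; suc; _+_; _*_; _≤_; _<_; z≤n; s≤s; _<?_)
open import Data.Nat.Properties hiding (_≟_)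
open import Algebra.Properties.Semiring.Sum +-*-semiring using (sum; sum-syntax; ∑-distrib-+)
open import Data.Product using (_×_; _,_; proj₁; proj₂; ∃-syntax)
open import Data.Vec using ([]; _∷_; lookup)
open import Data.Vec.Properties using (lookup∘tabulate)
open import Function using (_∘_; id; _∋_; Equivalence)
open import Relation.Binary.PropositionalEquality
open import Relation.Nullary using (Dec; ¬_; yes; no)
open import Relation.Nullary.Decidable using (⌊_⌋; dec-true; dec-false; isYes≗does)

open Equivalence using (to; from)

-- Finite sums

∑-mono-≤ : ∀ {n} {f g : Fin n → ℕ} → (∀ i → f i ≤ g i) → sum f ≤ sum g
∑-mono-≤ {zero}  f≤g = z≤n
∑-mono-≤ {suc n} f≤g = +-mono-≤ (f≤g zero) (∑-mono-≤ (f≤g ∘ suc))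

∑-const-1 : ∀ n → sum {n} (λ _ → 1) ≡ n
∑-const-1 zero    = refl
∑-const-1 (suc n) = cong suc (∑-const-1 n)

∑-+1≤ : ∀ {n} {f g : Fin n → ℕ} → (∀ i → f i + 1 ≤ g i) → sum f + n ≤ sum g
∑-+1≤ {n} {f} {g} f+1≤g = begin
  sum f + n                  ≡⟨ cong (sum f +_) (∑-const-1 n) ⟨
  sum f + sum {n} (λ _ → 1)  ≡⟨ ∑-distrib-+ f (λ _ → 1) ⟨
  sum (λ i → f i + 1)        ≤⟨ ∑-mono-≤ f+1≤g ⟩
  sum g                      ∎
  where open ≤-Reasoning

∑-≤+1 : ∀ {n} {f g : Fin n → ℕ} → (∀ i → f i ≤ g i + 1) → sum f ≤ sum g + n
∑-≤+1 {n} {f} {g} f≤g+1 = begin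
  sum f                      ≤⟨ ∑-mono-≤ f≤g+1 ⟩
  sum (λ i → g i + 1)        ≡⟨ ∑-distrib-+ g (λ _ → 1) ⟩
  sum g + sum {n} (λ _ → 1)  ≡⟨ cong (sum g +_) (∑-const-1 n) ⟩
  sum g + n                  ∎
  where open ≤-Reasoning

∑-≤-head-excess : ∀ {m} {f g : Fin (suc m) → ℕ} →
  f zero ≤ g zero + m → (∀ i → f (suc i) + 1 ≤ g (suc i)) → sum f ≤ sum g
∑-≤-head-excess {m} {f} {g} head tail = begin
  f zero + sum (f ∘ suc)        ≤⟨ +-monoˡ-≤ _ head ⟩
  g zero + m + sum (f ∘ suc)    ≡⟨ +-assoc (g zero) m _ ⟩
  g zero + (m + sum (f ∘ suc))  ≡⟨ cong (g zero +_) (+-comm m _) ⟩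
  g zero + (sum (f ∘ suc) + m)  ≤⟨ +-monoʳ-≤ (g zero) (∑-+1≤ tail) ⟩
  g zero + sum (g ∘ suc)        ∎
  where open ≤-Reasoning

∑-≤-tail-excess : ∀ {m} {f g : Fin (suc m) → ℕ} →
  f zero + m ≤ g zero → (∀ i → f (suc i) ≤ g (suc i) + 1) → sum f ≤ sum g
∑-≤-tail-excess {m} {f} {g} head tail = begin
  f zero + sum (f ∘ suc)        ≤⟨ +-monoʳ-≤ (f zero) (∑-≤+1 tail) ⟩
  f zero + (sum (g ∘ suc) + m)  ≡⟨ cong (f zero +_) (+-comm _ m) ⟩
  f zero + (m + sum (g ∘ suc))  ≡⟨ +-assoc (f zero) m _ ⟨
  f zero + m + sum (g ∘ suc)    ≤⟨ +-monoˡ-≤ _ head ⟩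
  g zero + sum (g ∘ suc)        ∎
  where open ≤-Reasoning

∑-split : ∀ m {n} (f : Fin (m + n) → ℕ) → sum f ≡ sum (f ∘ (_↑ˡ n)) + sum (f ∘ (m ↑ʳ_))
∑-split zero    f = refl
∑-split (suc m) f = trans (cong (f zero +_) (∑-split m (f ∘ suc))) (sym (+-assoc (f zero) _ _))

∑-combine : ∀ m n (f : Fin (m * n) → ℕ) → sum f ≡ ∑[ i < m ] ∑[ j < n ] f (combine i j)
∑-combine zero    n f = refl
∑-combine (suc m) n f = trans (∑-split n f) (cong (sum (f ∘ (_↑ˡ m * n)) +_) (∑-combine m n (f ∘ (n ↑ʳ_))))

∑-≤-by-blocks : ∀ m n {f g : Fin (m * n) → ℕ} →
  (∀ i → ∑[ j < n ] f (combine i j) ≤ ∑[ j < n ] g (combine i j)) → sum f ≤ sum g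
∑-≤-by-blocks m n {f} {g} blocks =
  subst₂ _≤_ (sym (∑-combine m n f)) (sym (∑-combine m n g)) (∑-mono-≤ {m} blocks)

-- Costs as finite sums

charge : ℕ → Bool → ℕ
charge α true  = α
charge α false = 0

*-∣∣≡∑-charge : ∀ α {n} (p : Subset n) → α * ∣ p ∣ ≡ ∑[ y < n ] charge α (lookup p y)
*-∣∣≡∑-charge α []          = *-zeroʳ α
*-∣∣≡∑-charge α (true ∷ p)  = trans (*-suc α ∣ p ∣) (cong (α +_) (*-∣∣≡∑-charge α p))
*-∣∣≡∑-charge α (false ∷ p) = *-∣∣≡∑-charge α p

charge≤ : ∀ α b → charge α b ≤ α
charge≤ α true  = ≤-refl
charge≤ α false = z≤n

cost-term : ∀ {n} → ℕ → Subset n → (Fin n → ℕ) → Fin n → ℕ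
cost-term α s D y = charge α (lookup s y) + D y

dist≤cost-term : ∀ {n} α s (D : Fin n → ℕ) y → D y ≤ cost-term α s D y
dist≤cost-term α s D y = m≤n+m (D y) _

sum∞-tabulate : ∀ {n} {f : Fin n → Maybe ℕ} {g : Fin n → ℕ} →
  (∀ y → f y ≡ just (g y)) → sum∞ (tabulate f) ≡ just (sum g)
sum∞-tabulate {zero}  f≡g = refl
sum∞-tabulate {suc n} f≡g rewrite f≡g zero | sum∞-tabulate (f≡g ∘ suc) = refl

sum∞-tabulate-finite : ∀ {n} (f : Fin n → Maybe ℕ) {c} →
  sum∞ (tabulate f) ≡ just c → ∀ y → ∃[ d ] f y ≡ just d
sum∞-tabulate-finite {suc n} f eq y with f zero in f₀ | sum∞ (tabulate (f ∘ suc)) in rest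
sum∞-tabulate-finite {suc n} f eq zero    | just a | just b = a , f₀
sum∞-tabulate-finite {suc n} f eq (suc y) | just a | just b = sum∞-tabulate-finite (f ∘ suc) rest y

module _ {n} (α : ℕ) (S : Profile n) (v : Fin n) where

  cost≡∑ : {D : Fin n → ℕ} → (∀ y → dist S v y ≡ just (D y)) →
    cost α S v ≡ just (∑[ y < n ] cost-term α (S v) D y)
  cost≡∑ {D} dist≡D rewrite map-tabulate {n = n} id (dist S v) | sum∞-tabulate dist≡D =
    cong just (trans (cong (_+ sum D) (*-∣∣≡∑-charge α (S v))) (sym (∑-distrib-+ _ D)))

  cost-finite : ∀ {c} → cost α S v ≡ just c → ∀ y → ∃[ d ] dist S v y ≡ just d
  cost-finite eq with sum∞ (map (dist S v) (allFin n)) in sums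
  ... | just b rewrite map-tabulate {n = n} id (dist S v) = sum∞-tabulate-finite (dist S v) sums

no-improvement : ∀ {n} α (S T : Profile n) v →
  (∀ y → ∃[ d ] dist S v y ≡ just d) →
  (∀ E D → (∀ y → dist S v y ≡ just (E y)) → (∀ y → dist T v y ≡ just (D y)) →
     ∑[ y < n ] cost-term α (S v) E y ≤ ∑[ y < n ] cost-term α (T v) D y) →
  ¬ (cost α T v <∞ cost α S v)
no-improvement {n} α S T v S-finite compare T<S with cost α T v in costT
... | just c = <⇒≱ (subst (just c <∞_) (cost≡∑ α S v dist≡E) T<S)
                   (subst (∑[ y < n ] cost-term α (S v) E y ≤_) (sym c≡∑) (compare E D dist≡E dist≡D))
  where
  E D : Fin n → ℕ
  E y = proj₁ (S-finite y)
  D y = proj₁ (cost-finite α T v costT y)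
  dist≡E : ∀ y → dist S v y ≡ just (E y)
  dist≡E y = proj₂ (S-finite y)
  dist≡D : ∀ y → dist T v y ≡ just (D y)
  dist≡D y = proj₂ (cost-finite α T v costT y)
  c≡∑ : c ≡ ∑[ y < n ] cost-term α (T v) D y
  c≡∑ = just-injective (trans (sym costT) (cost≡∑ α T v dist≡D))

-- Walks and distances in an arbitrary profile

⌊⌋-true : ∀ {p} {P : Set p} (P? : Dec P) → P → ⌊ P? ⌋ ≡ true
⌊⌋-true P? p = trans (isYes≗does P?) (dec-true P? p)

⌊⌋-false : ∀ {p} {P : Set p} (P? : Dec P) → ¬ P → ⌊ P? ⌋ ≡ false
⌊⌋-false P? ¬p = trans (isYes≗does P?) (dec-false P? ¬p)

any-allFin⁺ : ∀ {n} (p : Fin n → Bool) z → p z ≡ true → any p (allFin n) ≡ true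
any-allFin⁺ p z pz = to T-≡ (any⁺ p (lose (∈-allFin z) (from T-≡ pz)))

any-allFin⁻ : ∀ {n} (p : Fin n → Bool) → any p (allFin n) ≡ true → ∃[ z ] p z ≡ true
any-allFin⁻ {n} p h with satisfied (any⁻ p (allFin n) (from T-≡ h))
... | z , pz = z , to T-≡ pz

-- Walk S d x y: a walk of length at most d, since stay is allowed at every d.
data Walk {n} (S : Profile n) : ℕ → Fin n → Fin n → Set where
  stay : ∀ {d x} → Walk S d x x
  step : ∀ {d x z y} → adj S x z ≡ true → Walk S d z y → Walk S (suc d) x y

module _ {n} {S : Profile n} where

  walk-mono : ∀ {d e x y} → d ≤ e → Walk S d x y → Walk S e x y
  walk-mono _         stay        = stay
  walk-mono (s≤s d≤e) (step xz w) = step xz (walk-mono d≤e w)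

  walk-isolated : ∀ {d x y} → (∀ z → adj S z y ≡ false) → x ≢ y → ¬ Walk S d x y
  walk-isolated isolated x≢y stay = x≢y refl
  walk-isolated {y = y} isolated x≢y (step {x = x} {z = z} xz w) with z ≟ y
  ... | yes refl = not-¬ xz (isolated x)
  ... | no  z≢y  = walk-isolated isolated z≢y w

  reach-refl : ∀ d x → reach S d x x ≡ true
  reach-refl zero    x = ⌊⌋-true (x ≟ x) refl
  reach-refl (suc d) x rewrite reach-refl d x = refl

  walk⇒reach : ∀ {d x y} → Walk S d x y → reach S d x y ≡ true
  walk⇒reach {d} {x} stay = reach-refl d x
  walk⇒reach {suc d} {x} {y} (step {z = z} xz w) =
    trans (cong (reach S d x y ∨_) (any-allFin⁺ _ z (cong₂ _∧_ xz (walk⇒reach w)))) (∨-zeroʳ _)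

  reach⇒walk : ∀ d x y → reach S d x y ≡ true → Walk S d x y
  reach⇒walk zero    x y r with x ≟ y
  ... | yes refl = stay
  reach⇒walk (suc d) x y r with reach S d x y in rᵈ
  ... | true  = walk-mono (n≤1+n d) (reach⇒walk d x y rᵈ)
  ... | false with any-allFin⁻ _ r
  ...   | z , xz∧zy = step (∧-conicalˡ _ _ xz∧zy) (reach⇒walk d z y (∧-conicalʳ _ _ xz∧zy))

  search-sound : ∀ i fuel x y {d} → search S i fuel x y ≡ just d → Walk S d x y
  search-sound i (suc fuel) x y found with reach S i x y in rⁱ
  search-sound i (suc fuel) x y refl  | true  = reach⇒walk i x y rⁱ
  search-sound i (suc fuel) x y found | false = search-sound (suc i) fuel x y found

  search-complete : ∀ i j fuel x y → Walk S (i + j) x y → j < fuel →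
    ∃[ d ] search S i fuel x y ≡ just d × d ≤ i + j
  search-complete i j (suc fuel) x y w j<fuel with reach S i x y in rⁱ
  ... | true = i , refl , m≤m+n i j
  search-complete i zero    (suc fuel) x y w _ | false =
    ⊥-elim (not-¬ (walk⇒reach (subst (λ e → Walk S e x y) (+-identityʳ i) w)) rⁱ)
  search-complete i (suc j) (suc fuel) x y w (s≤s j<fuel) | false
    rewrite +-suc i j = search-complete (suc i) j fuel x y w j<fuel

  dist⇒walk : ∀ {x y d} → dist S x y ≡ just d → Walk S d x y
  dist⇒walk {x} {y} = search-sound 0 (suc n) x y

  -- dist only searches lengths up to n.
  walk⇒dist≤ : ∀ {b x y} → Walk S b x y → b ≤ n → ∃[ d ] dist S x y ≡ just d × d ≤ b
  walk⇒dist≤ {b} {x} {y} w b≤n = search-complete 0 b (suc n) x y w (s≤s b≤n)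

  ¬walk⇒<dist : ∀ {m x y d} → ¬ Walk S m x y → dist S x y ≡ just d → m < d
  ¬walk⇒<dist {m} {d = d} ¬w dist≡d with m <? d
  ... | yes m<d = m<d
  ... | no  m≮d = ⊥-elim (¬w (walk-mono (≮⇒≥ m≮d) (dist⇒walk dist≡d)))

  dist-unreachable : ∀ {x y} → (∀ d → ¬ Walk S d x y) → dist S x y ≡ nothing
  dist-unreachable {x} {y} ¬w = go 0 (suc n)
    where
    go : ∀ i fuel → search S i fuel x y ≡ nothing
    go i zero = refl
    go i (suc fuel) with reach S i x y in rⁱ
    ... | true  = ⊥-elim (¬w i (reach⇒walk i x y rⁱ))
    ... | false = go (suc i) fuel

  walk⇒finite : ∀ {b x y} → Walk S b x y → b ≤ n → ∃[ d ] dist S x y ≡ just d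
  walk⇒finite w b≤n with walk⇒dist≤ w b≤n
  ... | d , dist≡d , _ = d , dist≡d

  dist-≤-walk : ∀ {b x y e} → dist S x y ≡ just e → Walk S b x y → b ≤ n → e ≤ b
  dist-≤-walk dist≡e w b≤n with walk⇒dist≤ w b≤n
  ... | d , dist≡d , d≤b = subst (_≤ _) (just-injective (trans (sym dist≡d) dist≡e)) d≤b

  dist-≥₁ : ∀ {x y d} → x ≢ y → dist S x y ≡ just d → 1 ≤ d
  dist-≥₁ x≢y = ¬walk⇒<dist λ { stay → x≢y refl }

  dist-≥₂ : ∀ {x y d} → x ≢ y → adj S x y ≡ false → dist S x y ≡ just d → 2 ≤ d
  dist-≥₂ x≢y ¬xy = ¬walk⇒<dist λ { stay → x≢y refl ; (step xy stay) → not-¬ xy ¬xy }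

  dist-≥₃ : ∀ {x y d} → x ≢ y → adj S x y ≡ false →
    (∀ z → adj S x z ≡ true → ¬ adj S z y ≡ true) → dist S x y ≡ just d → 3 ≤ d
  dist-≥₃ x≢y ¬xy ¬xzy = ¬walk⇒<dist λ
    { stay                     → x≢y refl
    ; (step xy stay)           → not-¬ xy ¬xy
    ; (step xz (step zy stay)) → ¬xzy _ xz zy
    }

  dist-isolated : ∀ {x y} → (∀ z → adj S z y ≡ false) → x ≢ y → dist S x y ≡ nothing
  dist-isolated isolated x≢y = dist-unreachable (λ d → walk-isolated isolated x≢y)

adj-sym : ∀ {n} (S : Profile n) x y → adj S x y ≡ adj S y x
adj-sym S x y = ∨-comm (lookup (S x) y) (lookup (S y) x)

module _ {n} (S : Profile n) (v : Fin n) (s : Subset n) where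

  deviate-self : deviate S v s v ≡ s
  deviate-self rewrite ⌊⌋-true (v ≟ v) refl = refl

  deviate-other : ∀ {w} → w ≢ v → deviate S v s w ≡ S w
  deviate-other {w} w≢v rewrite ⌊⌋-false (w ≟ v) w≢v = refl

-- The clique with pendant leaves

distinct⇒2≤ : ∀ {k} {i j : Fin k} → i ≢ j → 2 ≤ k
distinct⇒2≤ {i = zero}  {j = zero}  i≢j = ⊥-elim (i≢j refl)
distinct⇒2≤ {i = zero}  {j = suc j} _   = s≤s (≤-trans (s≤s z≤n) (toℕ<n j))
distinct⇒2≤ {i = suc i}             _   = s≤s (≤-trans (s≤s z≤n) (toℕ<n i))

module Clique (a k : ℕ) (o : Fin k → Fin k → Bool) (tournament : Tournament o) where

  α n : ℕ
  α = 2 + a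
  n = k * α

  S : Profile n
  S = clique-profile k α o

  centre : Fin k → Fin n
  centre i = combine i zero

  leaf : Fin k → Fin (suc a) → Fin n
  leaf i t = combine i (suc t)

  centre-buys-centre : ∀ i j → lookup (S (centre i)) (centre j) ≡ not ⌊ i ≟ j ⌋ ∧ o i j
  centre-buys-centre i j
    rewrite (lookup (S (centre i)) (centre j) ≡ _) ∋ lookup∘tabulate _ (centre j)
          | remQuot-combine {k} {α} i zero | remQuot-combine {k} {α} j zero = refl

  centre-buys-leaf : ∀ i j t → lookup (S (centre i)) (leaf j t) ≡ ⌊ i ≟ j ⌋
  centre-buys-leaf i j t
    rewrite (lookup (S (centre i)) (leaf j t) ≡ _) ∋ lookup∘tabulate _ (leaf j t)
          | remQuot-combine {k} {α} i zero | remQuot-combine {k} {α} j (suc t) = refl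

  leaf-buys-nothing : ∀ i t y → lookup (S (leaf i t)) y ≡ false
  leaf-buys-nothing i t y
    rewrite (lookup (S (leaf i t)) y ≡ _) ∋ lookup∘tabulate _ y
          | remQuot-combine {k} {α} i (suc t) = refl

  adj-centres : ∀ {i j} → i ≢ j → adj S (centre i) (centre j) ≡ true
  adj-centres {i} {j} i≢j
    rewrite centre-buys-centre i j | centre-buys-centre j i
          | ⌊⌋-false (i ≟ j) i≢j | ⌊⌋-false (j ≟ i) (i≢j ∘ sym)
          | sym (tournament i j i≢j) = ∨-inverseʳ (o i j)

  adj-own-leaf : ∀ i t → adj S (centre i) (leaf i t) ≡ true
  adj-own-leaf i t rewrite centre-buys-leaf i i t | ⌊⌋-true (i ≟ i) refl = refl

  adj-leaf-centre : ∀ i t → adj S (leaf i t) (centre i) ≡ true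
  adj-leaf-centre i t = trans (adj-sym S (leaf i t) (centre i)) (adj-own-leaf i t)

  leaf-buyer : ∀ {z j t} → lookup (S z) (leaf j t) ≡ true → z ≡ centre j
  leaf-buyer {z} {j} {t} buys with combine-surjective {k} {α} z
  ... | i , suc u , refl = ⊥-elim (not-¬ buys (leaf-buys-nothing i u (leaf j t)))
  ... | i , zero  , refl with i ≟ j
  ...   | yes refl = refl
  ...   | no  i≢j  = ⊥-elim (not-¬ buys (trans (centre-buys-leaf i j t) (⌊⌋-false (i ≟ j) i≢j)))

  centre→leaf : ∀ i t → Walk S 1 (centre i) (leaf i t)
  centre→leaf i t = step (adj-own-leaf i t) stay

  2≤n : Fin k → 2 ≤ n
  2≤n i = ≤-trans (m≤m+n 2 a) (m≤n*m α k {{nonZeroIndex i}})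

  1≤n : Fin k → 1 ≤ n
  1≤n i = ≤-trans (n≤1+n 1) (2≤n i)

  3≤n : ∀ {i j : Fin k} → i ≢ j → 3 ≤ n
  3≤n i≢j = ≤-trans (n≤1+n 3) (≤-trans (*-monoʳ-≤ 2 (s≤s (s≤s z≤n))) (*-monoˡ-≤ α (distinct⇒2≤ i≢j)))

  combine-≢ˡ : ∀ {i j t u} → i ≢ j → combine {k} {α} i t ≢ combine j u
  combine-≢ˡ {i} {j} {t} {u} i≢j eq = i≢j (proj₁ (combine-injective i t j u eq))

  combine-≢ʳ : ∀ {i j t u} → t ≢ u → combine {k} {α} i t ≢ combine j u
  combine-≢ʳ {i} {j} {t} {u} t≢u eq = t≢u (proj₂ (combine-injective i t j u eq))

  module Deviation (v : Fin n) (s : Subset n) where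

    T : Profile n
    T = deviate S v s

    adj-deviator : ∀ {y} → y ≢ v → adj T v y ≡ lookup s y ∨ lookup (S y) v
    adj-deviator y≢v rewrite deviate-self S v s | deviate-other S v s y≢v = refl

    unbought-leaf-apart : ∀ {j t} → leaf j t ≢ v → lookup s (leaf j t) ≡ false → adj T v (leaf j t) ≡ false
    unbought-leaf-apart {j} {t} ℓ≢v ℓ∉s rewrite adj-deviator ℓ≢v | ℓ∉s = leaf-buys-nothing j t v

    unbought-leaf-neighbours : ∀ {j t z} → leaf j t ≢ v → lookup s (leaf j t) ≡ false →
      adj T z (leaf j t) ≡ true → z ≢ v × z ≡ centre j
    unbought-leaf-neighbours {j} {t} {z} ℓ≢v ℓ∉s zℓ
      rewrite deviate-other S v s ℓ≢v | leaf-buys-nothing j t z | ∨-identityʳ (lookup (T z) (leaf j t))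
      with z ≟ v
    ... | yes refl = ⊥-elim (not-¬ zℓ ℓ∉s)
    ... | no  z≢v  = z≢v , leaf-buyer zℓ

    unprofitable : (∀ y → ∃[ d ] dist S v y ≡ just d) →
      (∀ {E D} → (∀ y → dist S v y ≡ just (E y)) → (∀ y → dist T v y ≡ just (D y)) → ∀ j →
         ∑[ t < α ] cost-term α (S v) E (combine j t) ≤ ∑[ t < α ] cost-term α s D (combine j t)) →
      ¬ (cost α T v <∞ cost α S v)
    unprofitable finite blocks = no-improvement α S T v finite λ E D dist≡E dist≡D →
      subst (λ p → sum (cost-term α (S v) E) ≤ sum (cost-term α p D)) (sym (deviate-self S v s))
            (∑-≤-by-blocks k α (blocks dist≡E dist≡D))

    module _ {D : Fin n → ℕ} (dist≡D : ∀ y → dist T v y ≡ just (D y)) where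

      dist≥1 : ∀ {y} → y ≢ v → 1 ≤ D y
      dist≥1 {y} y≢v = dist-≥₁ (y≢v ∘ sym) (dist≡D y)

      bought-≥ : ∀ {y} → y ≢ v → lookup s y ≡ true → α + 1 ≤ cost-term α s D y
      bought-≥ y≢v y∈s rewrite y∈s = +-monoʳ-≤ α (dist≥1 y≢v)

      leaf-≥₂ : ∀ {j t} → leaf j t ≢ v → 2 ≤ cost-term α s D (leaf j t)
      leaf-≥₂ {j} {t} ℓ≢v with lookup s (leaf j t) in ℓ∈s
      ... | true  = ≤-trans (m≤m+n 2 (a + 1)) (+-monoʳ-≤ α (dist≥1 ℓ≢v))
      ... | false = dist-≥₂ (ℓ≢v ∘ sym) (unbought-leaf-apart ℓ≢v ℓ∈s) (dist≡D _)

      leaf-≥₃ : ∀ {j t} → leaf j t ≢ v → adj T v (centre j) ≡ false → 3 ≤ cost-term α s D (leaf j t)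
      leaf-≥₃ {j} {t} ℓ≢v ¬vc with lookup s (leaf j t) in ℓ∈s
      ... | true  = ≤-trans (s≤s (s≤s (m≤n+m 1 a))) (+-monoʳ-≤ α (dist≥1 ℓ≢v))
      ... | false = dist-≥₃ (ℓ≢v ∘ sym) (unbought-leaf-apart ℓ≢v ℓ∈s) no-common-neighbour (dist≡D _)
        where
        no-common-neighbour : ∀ z → adj T v z ≡ true → ¬ adj T z (leaf j t) ≡ true
        no-common-neighbour z vz zℓ with unbought-leaf-neighbours ℓ≢v ℓ∈s zℓ
        ... | _ , refl = not-¬ vz ¬vc

  module Centre-deviation (i : Fin k) (s : Subset n) where
    open Deviation (centre i) s

    walk-centre : ∀ {j} → j ≢ i → Walk S 1 (centre i) (centre j)
    walk-centre j≢i = step (adj-centres (j≢i ∘ sym)) stay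

    walk-leaf : ∀ {j} → j ≢ i → ∀ t → Walk S 2 (centre i) (leaf j t)
    walk-leaf {j} j≢i t = step (adj-centres (j≢i ∘ sym)) (centre→leaf j t)

    finite : ∀ y → ∃[ d ] dist S (centre i) y ≡ just d
    finite y with combine-surjective {k} {α} y
    ... | j , t , refl with j ≟ i | t
    ...   | yes refl | zero  = walk⇒finite (stay {x = centre i}) z≤n
    ...   | yes refl | suc t = walk⇒finite (centre→leaf i t) (1≤n i)
    ...   | no  j≢i  | zero  = walk⇒finite (walk-centre j≢i) (1≤n i)
    ...   | no  j≢i  | suc t = walk⇒finite (walk-leaf j≢i t) (2≤n i)

    own-leaf≢ : ∀ t → leaf i t ≢ centre i
    own-leaf≢ t = combine-≢ʳ λ ()

    own-leaf-isolated : ∀ t → lookup s (leaf i t) ≡ false → ∀ z → adj T z (leaf i t) ≡ false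
    own-leaf-isolated t ℓ∉s z with adj T z (leaf i t) in zℓ
    ... | false = refl
    ... | true with unbought-leaf-neighbours (own-leaf≢ t) ℓ∉s zℓ
    ...   | z≢v , refl = ⊥-elim (z≢v refl)

    module _ {E D : Fin n → ℕ} (dist≡E : ∀ y → dist S (centre i) y ≡ just (E y))
             (dist≡D : ∀ y → dist T (centre i) y ≡ just (D y)) where

      old new : Fin n → ℕ
      old = cost-term α (S (centre i)) E
      new = cost-term α s D

      own-leaf-bought : ∀ t → lookup s (leaf i t) ≡ true
      own-leaf-bought t with lookup s (leaf i t) in ℓ∈s
      ... | true  = refl
      ... | false with trans (sym (dist-isolated (own-leaf-isolated t ℓ∈s) (own-leaf≢ t ∘ sym))) (dist≡D _)
      ...   | ()

      own-block : ∑[ t < α ] old (combine i t) ≤ ∑[ t < α ] new (combine i t)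
      own-block = ∑-mono-≤ {α} {old ∘ combine i} {new ∘ combine i} λ
        { zero    → own-centre
        ; (suc t) → own-leaf t
        }
        where
        own-centre : old (centre i) ≤ new (centre i)
        own-centre rewrite centre-buys-centre i i | ⌊⌋-true (i ≟ i) refl =
          ≤-trans (dist-≤-walk (dist≡E _) (stay {x = centre i}) z≤n) z≤n
        own-leaf : ∀ t → old (leaf i t) ≤ new (leaf i t)
        own-leaf t rewrite centre-buys-leaf i i t | ⌊⌋-true (i ≟ i) refl =
          ≤-trans (+-monoʳ-≤ α (dist-≤-walk (dist≡E _) (centre→leaf i t) (1≤n i)))
                  (bought-≥ dist≡D (own-leaf≢ t) (own-leaf-bought t))

      module _ {j : Fin k} (j≢i : j ≢ i) where

        centre≢ : centre j ≢ centre i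
        centre≢ = combine-≢ˡ j≢i

        leaf≢ : ∀ t → leaf j t ≢ centre i
        leaf≢ t = combine-≢ˡ j≢i

        old-centre : old (centre j) ≤ α + 1
        old-centre = +-mono-≤ (charge≤ α _) (dist-≤-walk (dist≡E _) (walk-centre j≢i) (1≤n i))

        old-centre-inward : o j i ≡ true → old (centre j) ≤ 1
        old-centre-inward oji
          rewrite centre-buys-centre i j | ⌊⌋-false (i ≟ j) (j≢i ∘ sym)
                | trans (sym (tournament j i j≢i)) (cong not oji) =
          dist-≤-walk (dist≡E _) (walk-centre j≢i) (1≤n i)

        old-leaf : ∀ t → old (leaf j t) ≤ 2
        old-leaf t rewrite centre-buys-leaf i j t | ⌊⌋-false (i ≟ j) (j≢i ∘ sym) =
          dist-≤-walk (dist≡E _) (walk-leaf j≢i t) (2≤n i)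

        cut-off : lookup s (centre j) ≡ false → o j i ≡ false → adj T (centre i) (centre j) ≡ false
        cut-off c∉s oji
          rewrite adj-deviator centre≢ | c∉s | centre-buys-centre j i | ⌊⌋-false (j ≟ i) j≢i | oji = refl

        pointwise : old (centre j) ≤ new (centre j) → ∑[ t < α ] old (combine j t) ≤ ∑[ t < α ] new (combine j t)
        pointwise centre-≤ = ∑-mono-≤ {α} {old ∘ combine j} {new ∘ combine j} λ
          { zero    → centre-≤
          ; (suc t) → ≤-trans (old-leaf t) (leaf-≥₂ dist≡D (leaf≢ t))
          }

        other-block : ∀ {b c} → lookup s (centre j) ≡ b → o j i ≡ c →
          ∑[ t < α ] old (combine j t) ≤ ∑[ t < α ] new (combine j t)
        other-block {true}          c∈s _   = pointwise (≤-trans old-centre (bought-≥ dist≡D centre≢ c∈s))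
        other-block {false} {true}  _   oji = pointwise (≤-trans (old-centre-inward oji)
                                             (≤-trans (dist≥1 dist≡D centre≢) (dist≤cost-term α s D _)))
        other-block {false} {false} c∉s oji = ∑-≤-head-excess {suc a} {old ∘ combine j} {new ∘ combine j}
          (≤-trans old-centre (≤-trans (≤-reflexive (+-comm α 1)) (+-monoˡ-≤ (suc a)
            (≤-trans (dist-≥₂ (centre≢ ∘ sym) (cut-off c∉s oji) (dist≡D _)) (dist≤cost-term α s D _)))))
          (λ t → ≤-trans (+-monoˡ-≤ 1 (old-leaf t)) (leaf-≥₃ dist≡D (leaf≢ t) (cut-off c∉s oji)))

      blocks : ∀ j → ∑[ t < α ] old (combine j t) ≤ ∑[ t < α ] new (combine j t)
      blocks j with j ≟ i
      ... | yes refl = own-block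
      ... | no  j≢i  = other-block j≢i refl refl

    no-gain : ¬ (cost α T (centre i) <∞ cost α S (centre i))
    no-gain = unprofitable finite blocks

  module Leaf-deviation (i : Fin k) (t₀ : Fin (suc a)) (s : Subset n) where
    open Deviation (leaf i t₀) s

    walk-own-centre : Walk S 1 (leaf i t₀) (centre i)
    walk-own-centre = step (adj-leaf-centre i t₀) stay

    walk-own-leaf : ∀ t → Walk S 2 (leaf i t₀) (leaf i t)
    walk-own-leaf t = step (adj-leaf-centre i t₀) (centre→leaf i t)

    walk-centre : ∀ {j} → j ≢ i → Walk S 2 (leaf i t₀) (centre j)
    walk-centre j≢i = step (adj-leaf-centre i t₀) (step (adj-centres (j≢i ∘ sym)) stay)

    walk-leaf : ∀ {j} → j ≢ i → ∀ t → Walk S 3 (leaf i t₀) (leaf j t)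
    walk-leaf {j} j≢i t =
      step (adj-leaf-centre i t₀) (step (adj-centres (j≢i ∘ sym)) (centre→leaf j t))

    finite : ∀ y → ∃[ d ] dist S (leaf i t₀) y ≡ just d
    finite y with combine-surjective {k} {α} y
    ... | j , t , refl with j ≟ i | t
    ...   | yes refl | zero  = walk⇒finite walk-own-centre (1≤n i)
    ...   | no  j≢i  | zero  = walk⇒finite (walk-centre j≢i) (2≤n i)
    ...   | no  j≢i  | suc t = walk⇒finite (walk-leaf j≢i t) (3≤n (j≢i ∘ sym))
    ...   | yes refl | suc t with t ≟ t₀
    ...     | yes refl = walk⇒finite (stay {x = leaf i t₀}) z≤n
    ...     | no  _    = walk⇒finite (walk-own-leaf t) (2≤n i)

    module _ {E D : Fin n → ℕ} (dist≡E : ∀ y → dist S (leaf i t₀) y ≡ just (E y))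
             (dist≡D : ∀ y → dist T (leaf i t₀) y ≡ just (D y)) where

      old new : Fin n → ℕ
      old = cost-term α (S (leaf i t₀)) E
      new = cost-term α s D

      old≡dist : ∀ y → old y ≡ E y
      old≡dist y rewrite leaf-buys-nothing i t₀ y = refl

      own-block : ∑[ t < α ] old (combine i t) ≤ ∑[ t < α ] new (combine i t)
      own-block = ∑-mono-≤ {α} {old ∘ combine i} {new ∘ combine i} λ
        { zero    → own-centre
        ; (suc t) → own-leaf t (t ≟ t₀)
        }
        where
        own-centre : old (centre i) ≤ new (centre i)
        own-centre rewrite old≡dist (centre i) =
          ≤-trans (dist-≤-walk (dist≡E _) walk-own-centre (1≤n i))
                  (≤-trans (dist≥1 dist≡D (combine-≢ʳ λ ())) (dist≤cost-term α s D _))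
        own-leaf : ∀ t → Dec (t ≡ t₀) → old (leaf i t) ≤ new (leaf i t)
        own-leaf t (yes refl) rewrite old≡dist (leaf i t) =
          ≤-trans (dist-≤-walk (dist≡E _) (stay {x = leaf i t₀}) z≤n) z≤n
        own-leaf t (no t≢t₀) rewrite old≡dist (leaf i t) =
          ≤-trans (dist-≤-walk (dist≡E _) (walk-own-leaf t) (2≤n i))
                  (leaf-≥₂ dist≡D (combine-≢ʳ (t≢t₀ ∘ Fin.suc-injective)))

      module _ {j : Fin k} (j≢i : j ≢ i) where

        centre≢ : centre j ≢ leaf i t₀
        centre≢ = combine-≢ˡ j≢i

        leaf≢ : ∀ t → leaf j t ≢ leaf i t₀
        leaf≢ t = combine-≢ˡ j≢i

        old-centre : old (centre j) ≤ 2
        old-centre rewrite old≡dist (centre j) = dist-≤-walk (dist≡E _) (walk-centre j≢i) (2≤n i)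

        old-leaf : ∀ t → old (leaf j t) ≤ 3
        old-leaf t rewrite old≡dist (leaf j t) = dist-≤-walk (dist≡E _) (walk-leaf j≢i t) (3≤n (j≢i ∘ sym))

        cut-off : lookup s (centre j) ≡ false → adj T (leaf i t₀) (centre j) ≡ false
        cut-off c∉s rewrite adj-deviator centre≢ | c∉s | centre-buys-leaf j i t₀ = ⌊⌋-false (j ≟ i) j≢i

        other-block : ∀ {b} → lookup s (centre j) ≡ b →
          ∑[ t < α ] old (combine j t) ≤ ∑[ t < α ] new (combine j t)
        other-block {true} c∈s = ∑-≤-tail-excess {suc a} {old ∘ combine j} {new ∘ combine j}
          (≤-trans (+-monoˡ-≤ (suc a) old-centre) (≤-trans (≤-reflexive (+-comm 1 α)) (bought-≥ dist≡D centre≢ c∈s)))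
          (λ t → ≤-trans (old-leaf t) (+-monoˡ-≤ 1 (leaf-≥₂ dist≡D (leaf≢ t))))
        other-block {false} c∉s = ∑-mono-≤ {α} {old ∘ combine j} {new ∘ combine j} λ
          { zero    → ≤-trans old-centre (≤-trans (dist-≥₂ (centre≢ ∘ sym) (cut-off c∉s) (dist≡D _))
                                                (dist≤cost-term α s D _))
          ; (suc t) → ≤-trans (old-leaf t) (leaf-≥₃ dist≡D (leaf≢ t) (cut-off c∉s))
          }

      blocks : ∀ j → ∑[ t < α ] old (combine j t) ≤ ∑[ t < α ] new (combine j t)
      blocks j with j ≟ i
      ... | yes refl = own-block
      ... | no  j≢i  = other-block j≢i refl

    no-gain : ¬ (cost α T (leaf i t₀) <∞ cost α S (leaf i t₀))
    no-gain = unprofitable finite blocks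

lemma10 : (α k : ℕ) → 2 ≤ α → 1 ≤ k →
    (o : Fin k → Fin k → Bool) → Tournament o →
    NashEquilibrium α (clique-profile k α o)
lemma10 (suc (suc a)) k (s≤s (s≤s z≤n)) _ o tournament v s _ with combine-surjective {k} {suc (suc a)} v
... | i , zero  , refl = Clique.Centre-deviation.no-gain a k o tournament i s
... | i , suc t , refl = Clique.Leaf-deviation.no-gain a k o tournament i t s
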